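{- There exists a measurable spined category $(\mathcal{C},\Omega,\mathfrak{P})$ in which the order map $X\mapsto|X|$ is not (the object map of) an S-functor.
   Context: A spined category is a triple $(\mathcal{C},\Omega,\mathfrak{P})$: a category $\mathcal{C}$, a sequence of objects $(\Omega_n)_{n\in\mathbb{N}}$, and an operation $\mathfrak{P}$ assigning to each span $G\xleftarrow{g}\Omega_n\xrightarrow{h}H$ an object $\mathfrak{P}(g,h)$ and morphisms $\mathfrak{P}(g,h)_g:G\to\mathfrak{P}(g,h)$, $\mathfrak{P}(g,h)_h:H\to\mathfrak{P}(g,h)$ with $\mathfrak{P}(g,h)_gg=\mathfrak{P}(g,h)_hh$, such that (SC1) every object has a morphism to some $\Omega_n$; (SC2) for every such span and all $g':G\to G'$, $h':H\to H'$ there is a unique morphism $(g',h'):\mathfrak{P}(g,h)\to\mathfrak{P}(g'g,h'h)$ with $(g',h')\mathfrak{P}(g,h)_g=\mathfrak{P}(g'g,h'h)_{g'g}g'$ and $(g',h')\mathfrak{P}(g,h)_h=\mathfrak{P}(g'g,h'h)_{h'h}h'$. The order $|X|$ of an object $X$ is the least $n$ such that there is a morphism $X\to\Omega_n$. An S-functor is a functor $F$ to the poset $(\mathbb{N},\le)$ with $F(\Omega_n)=n$ and $F(\mathfrak{P}(g,h))=\max\{F(G),F(H)\}$ for every span $G\xleftarrow{g}\Omega_n\xrightarrow{h}H$; measurable means at least one S-functor exists. -}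

module Defs where

open import Level using (Level; _⊔_; suc)
open import Data.Nat using (ℕ; _≤_) renaming (_⊔_ to max)
open import Data.Product using (Σ; _×_; _,_)
open import Relation.Binary.PropositionalEquality using (_≡_)

record Category (o h : Level) : Set (suc (o ⊔ h)) where
  infixr 9 _∘_
  field
    Obj  : Set o
    Hom  : Obj → Obj → Set h
    id   : ∀ {A} → Hom A A
    _∘_  : ∀ {A B C} → Hom B C → Hom A B → Hom A C
    identityˡ : ∀ {A B} (f : Hom A B) → id ∘ f ≡ f
    identityʳ : ∀ {A B} (f : Hom A B) → f ∘ id ≡ f
    assoc : ∀ {A B C D} (f : Hom C D) (g : Hom B C) (k : Hom A B) →
            (f ∘ g) ∘ k ≡ f ∘ (g ∘ k)

record Spined {o h : Level} (C : Category o h) : Set (o ⊔ h) where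
  open Category C
  field
    Ω  : ℕ → Obj
    𝔓  : ∀ {n G H} (g : Hom (Ω n) G) (k : Hom (Ω n) H) → Obj
    𝔓₁ : ∀ {n G H} (g : Hom (Ω n) G) (k : Hom (Ω n) H) → Hom G (𝔓 g k)
    𝔓₂ : ∀ {n G H} (g : Hom (Ω n) G) (k : Hom (Ω n) H) → Hom H (𝔓 g k)
    𝔓-comm : ∀ {n G H} (g : Hom (Ω n) G) (k : Hom (Ω n) H) →
             𝔓₁ g k ∘ g ≡ 𝔓₂ g k ∘ k
    SC1 : ∀ X → Σ ℕ λ n → Hom X (Ω n)
    SC2 : ∀ {n G H G' H'} (g : Hom (Ω n) G) (k : Hom (Ω n) H)
            (g' : Hom G G') (k' : Hom H H') →
          Hom (𝔓 g k) (𝔓 (g' ∘ g) (k' ∘ k))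
    SC2-eq₁ : ∀ {n G H G' H'} (g : Hom (Ω n) G) (k : Hom (Ω n) H)
                (g' : Hom G G') (k' : Hom H H') →
              SC2 g k g' k' ∘ 𝔓₁ g k ≡ 𝔓₁ (g' ∘ g) (k' ∘ k) ∘ g'
    SC2-eq₂ : ∀ {n G H G' H'} (g : Hom (Ω n) G) (k : Hom (Ω n) H)
                (g' : Hom G G') (k' : Hom H H') →
              SC2 g k g' k' ∘ 𝔓₂ g k ≡ 𝔓₂ (g' ∘ g) (k' ∘ k) ∘ k'
    SC2-unique : ∀ {n G H G' H'} (g : Hom (Ω n) G) (k : Hom (Ω n) H)
                   (g' : Hom G G') (k' : Hom H H')
                   (u : Hom (𝔓 g k) (𝔓 (g' ∘ g) (k' ∘ k))) →
                 u ∘ 𝔓₁ g k ≡ 𝔓₁ (g' ∘ g) (k' ∘ k) ∘ g' →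
                 u ∘ 𝔓₂ g k ≡ 𝔓₂ (g' ∘ g) (k' ∘ k) ∘ k' →
                 u ≡ SC2 g k g' k'

module _ {o h : Level} {C : Category o h} (S : Spined C) where
  open Category C
  open Spined S

  IsOrder : Obj → ℕ → Set h
  IsOrder X n = Hom X (Ω n) × (∀ m → Hom X (Ω m) → n ≤ m)

  -- An S-functor: a functor C → (ℕ, ≤) (functor laws are automatic since
  -- the poset has at most one arrow between two objects).
  record SFunctor : Set (o ⊔ h) where
    field
      F₀ : Obj → ℕ
      F₁ : ∀ {X Y} → Hom X Y → F₀ X ≤ F₀ Y
      F-Ω : ∀ n → F₀ (Ω n) ≡ n
      F-𝔓 : ∀ {n G H} (g : Hom (Ω n) G) (k : Hom (Ω n) H) →
            F₀ (𝔓 g k) ≡ max (F₀ G) (F₀ H)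

  Measurable : Set (o ⊔ h)
  Measurable = SFunctor

  OrderIsSFunctor : Set (o ⊔ h)
  OrderIsSFunctor = Σ SFunctor λ F → ∀ X → IsOrder X (SFunctor.F₀ F X)

-- Take C = (ℕ, ≤) with a spine that skips the object 1, i.e. Ω 0 = 0 and
-- Ω (n + 1) = n + 2, and let the proxy pushout of G and H be 1 ⊔ G ⊔ H.
-- Then X ↦ X ∸ 1 is an S-functor. But 1 = 𝔓(Ω 0, Ω 0) has order 1, while an
-- S-functor must send it to max(0, 0) = 0.
module Submission where

open import Defs
open import Level using (Level; 0ℓ)
open import Data.Product using (Σ; _×_; _,_; proj₁)
open import Data.Nat using (ℕ; zero; suc; _≤_; _∸_; _⊔_; s≤s)
open import Data.Nat.Properties
  using ( ≤-preorder; ≤-irrelevant; ≤-refl; ≤-trans; n≤1+n; m≤m⊔n; m≤n⊔m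
        ; ⊔-mono-≤; ⊔-monoʳ-≤; ∸-monoˡ-≤; ∸-distribʳ-⊔ )
open import Relation.Binary.Bundles using (Preorder)
open import Relation.Binary.Definitions using (Irrelevant)
open import Relation.Binary.PropositionalEquality using (_≡_; refl; trans; cong₂; subst)
open import Relation.Nullary using (¬_)

thinCategory : ∀ {c ℓ₁ ℓ₂} (P : Preorder c ℓ₁ ℓ₂) →
               Irrelevant (Preorder._≲_ P) → Category c ℓ₂
thinCategory P irrelevant = record
  { Obj       = Carrier
  ; Hom       = _≲_
  ; id        = ≲-refl
  ; _∘_       = λ f g → ≲-trans g f
  ; identityˡ = λ _ → irrelevant _ _
  ; identityʳ = λ _ → irrelevant _ _
  ; assoc     = λ _ _ _ → irrelevant _ _
  }
  where open Preorder P using (Carrier; _≲_) renaming (refl to ≲-refl; trans to ≲-trans)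

-- In a thin category every equation between parallel morphisms holds, so a
-- spine together with a monotone upper-bound operation on objects is all a
-- spined structure needs.
module _ {c ℓ₁ ℓ₂} (P : Preorder c ℓ₁ ℓ₂) (irrelevant : Irrelevant (Preorder._≲_ P)) where
  open Preorder P using (Carrier; _≲_)

  thinSpined : (Ω : ℕ → Carrier) → (∀ X → Σ ℕ λ n → X ≲ Ω n) →
               (_∨_ : Carrier → Carrier → Carrier) →
               (∀ G H → G ≲ G ∨ H) → (∀ G H → H ≲ G ∨ H) →
               (∀ {G G′ H H′} → G ≲ G′ → H ≲ H′ → G ∨ H ≲ G′ ∨ H′) →
               Spined (thinCategory P irrelevant)
  thinSpined Ω toΩ _∨_ ∨-upperˡ ∨-upperʳ ∨-mono = record
    { Ω          = Ω
    ; 𝔓          = λ {_ G H} _ _ → G ∨ H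
    ; 𝔓₁         = λ {_ G H} _ _ → ∨-upperˡ G H
    ; 𝔓₂         = λ {_ G H} _ _ → ∨-upperʳ G H
    ; 𝔓-comm     = λ _ _ → irrelevant _ _
    ; SC1        = toΩ
    ; SC2        = λ _ _ g′ k′ → ∨-mono g′ k′
    ; SC2-eq₁    = λ _ _ _ _ → irrelevant _ _
    ; SC2-eq₂    = λ _ _ _ _ → irrelevant _ _
    ; SC2-unique = λ _ _ _ _ _ _ _ → irrelevant _ _
    }

module _ {o h : Level} {C : Category o h} (S : Spined C) where
  open Category C
  open Spined S

  OrderIsSFunctor⇒𝔓-to-Ω : OrderIsSFunctor S →
    ∀ {n a b} (g : Hom (Ω n) (Ω a)) (k : Hom (Ω n) (Ω b)) → Hom (𝔓 g k) (Ω (a ⊔ b))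
  OrderIsSFunctor⇒𝔓-to-Ω (F , isOrder) {a = a} {b} g k =
    subst (λ m → Hom (𝔓 g k) (Ω m)) order-𝔓 (proj₁ (isOrder (𝔓 g k)))
    where
    open SFunctor F
    order-𝔓 : F₀ (𝔓 g k) ≡ a ⊔ b
    order-𝔓 = trans (F-𝔓 g k) (cong₂ _⊔_ (F-Ω a) (F-Ω b))

skip1 : ℕ → ℕ
skip1 zero    = zero
skip1 (suc n) = suc (suc n)

n≤skip1 : ∀ n → n ≤ skip1 n
n≤skip1 zero    = ≤-refl
n≤skip1 (suc n) = s≤s (n≤1+n n)

_∨₁_ : ℕ → ℕ → ℕ
G ∨₁ H = 1 ⊔ (G ⊔ H)

skip1Spined : Spined (thinCategory ≤-preorder ≤-irrelevant)
skip1Spined = thinSpined ≤-preorder ≤-irrelevant skip1 (λ X → X , n≤skip1 X) _∨₁_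
  (λ G H → ≤-trans (m≤m⊔n G H) (m≤n⊔m 1 (G ⊔ H)))
  (λ G H → ≤-trans (m≤n⊔m G H) (m≤n⊔m 1 (G ⊔ H)))
  (λ G≤G′ H≤H′ → ⊔-monoʳ-≤ 1 (⊔-mono-≤ G≤G′ H≤H′))

predSFunctor : SFunctor skip1Spined
predSFunctor = record
  { F₀  = _∸ 1
  ; F₁  = ∸-monoˡ-≤ 1
  ; F-Ω = pred-skip1
  ; F-𝔓 = λ {_ G H} _ _ → trans (∸-distribʳ-⊔ 1 1 (G ⊔ H)) (∸-distribʳ-⊔ 1 G H)
  }
  where
  pred-skip1 : ∀ n → skip1 n ∸ 1 ≡ n
  pred-skip1 zero    = refl
  pred-skip1 (suc n) = refl

¬OrderIsSFunctor-skip1 : ¬ OrderIsSFunctor skip1Spined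
¬OrderIsSFunctor-skip1 order with OrderIsSFunctor⇒𝔓-to-Ω skip1Spined order {0} {0} {0} ≤-refl ≤-refl
... | ()

proposition3p12 : Σ (Category 0ℓ 0ℓ) λ C → Σ (Spined C) λ S →
    Measurable S × ¬ OrderIsSFunctor S
proposition3p12 = thinCategory ≤-preorder ≤-irrelevant , skip1Spined
                , predSFunctor , ¬OrderIsSFunctor-skip1
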